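{- Let $\mathcal{P}\subseteq\{0,1\}^{\mathbb{N}}$ be a non-empty clopen set. Then every weakly (Kurtz) random sequence $Z\in\{0,1\}^{\mathbb{N}}$ is multiply recurrent in $\mathcal{P}$, i.e. for every $k\ge 1$ there is $n\ge 1$ such that $T^{ni}(Z)\in\mathcal{P}$ for all $i$ with $1\le i\le k$.
   Context: Cantor space $\{0,1\}^{\mathbb{N}}$ carries the uniform (product) measure $\lambda$. $T\colon\{0,1\}^{\mathbb{N}}\to\{0,1\}^{\mathbb{N}}$ is the shift, which deletes the first bit of a sequence. A $\Pi^0_1$ class is an effectively closed subset of Cantor space, i.e. the complement of $\{Y:\exists\sigma\in S,\ \sigma\prec Y\}$ for some computably enumerable set $S$ of finite binary strings. $Z$ is weakly (Kurtz) random if $Z$ belongs to no $\Pi^0_1$ class of $\lambda$-measure $0$. For measurable $\mathcal{P}$, $Z$ is $k$-recurrent in $\mathcal{P}$ if there is $n\ge1$ with $Z\in\bigcap_{1\le i\le k}T^{ -ni}(\mathcal{P})$, and multiply recurrent in $\mathcal{P}$ if it is $k$-recurrent in $\mathcal{P}$ for every $k\ge1$. -}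

module Defs where

open import Data.Bool using (Bool; true; false)
open import Data.Nat using (ℕ; zero; suc; _+_; _*_; _≤_; _<_)
open import Data.Fin using (Fin)
open import Data.Vec using (Vec; []; _∷_; lookup)
open import Data.List using (List; []; _∷_; length)
open import Data.List.Relation.Unary.Any using (Any)
open import Data.Product using (Σ; ∃; _×_)
open import Relation.Binary.PropositionalEquality using (_≡_; _≢_)
import Data.Rational as ℚ
open ℚ using (ℚ)

Cantor : Set
Cantor = ℕ → Bool

Str : Set
Str = List Bool

data _≺_ : Str → Cantor → Set where
  []≺  : ∀ {Y} → [] ≺ Y
  ∷≺   : ∀ {b σ Y} → Y 0 ≡ b → σ ≺ (λ i → Y (suc i)) → (b ∷ σ) ≺ Y

T : Cantor → Cantor
T Y i = Y (suc i)

T^ : ℕ → Cantor → Cantor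
T^ zero    Y = Y
T^ (suc n) Y = T (T^ n Y)

Subset : Set₁
Subset = Cantor → Set

⟦_⟧ : (Str → Set) → Subset
⟦ S ⟧ Y = Σ Str λ σ → S σ × σ ≺ Y

½^ : ℕ → ℚ
½^ zero    = ℚ.1ℚ
½^ (suc n) = ℚ.½ ℚ.* ½^ n

weight : List Str → ℚ
weight []      = ℚ.0ℚ
weight (σ ∷ L) = ½^ (length σ) ℚ.+ weight L

-- λ(P) = 0 : for every m, P is covered by finitely many cylinders of
-- total measure ≤ 2^(-m).  (For the closed sets considered here finite
-- covers are the same as countable ones, by compactness.)
Null : Subset → Set
Null P = ∀ (m : ℕ) → Σ (List Str) λ L →
           (∀ Y → P Y → Any (λ σ → σ ≺ Y) L) × (weight L ℚ.≤ ½^ m)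

-- Computability: primitive recursive functions, c.e. sets via
-- Kleene normal form  (W = { x : ∃ t. R(x,t) ≠ 0 },  R primitive recursive).

data PR : ℕ → Set where
  zer  : ∀ {n} → PR n
  succ : PR 1
  proj : ∀ {n} → Fin n → PR n
  comp : ∀ {m n} → PR m → Vec (PR n) m → PR n
  prec : ∀ {n} → PR n → PR (suc (suc n)) → PR (suc n)

mutual
  eval : ∀ {n} → PR n → Vec ℕ n → ℕ
  eval zer          xs       = 0
  eval succ         (x ∷ []) = suc x
  eval (proj i)     xs       = lookup xs i
  eval (comp f gs)  xs       = eval f (evalV gs xs)
  eval (prec f g)   (zero ∷ xs)  = eval f xs
  eval (prec f g)   (suc y ∷ xs) = eval g (y ∷ eval (prec f g) (y ∷ xs) ∷ xs)

  evalV : ∀ {m n} → Vec (PR n) m → Vec ℕ n → Vec ℕ m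
  evalV []       xs = []
  evalV (g ∷ gs) xs = eval g xs ∷ evalV gs xs

-- bijective base-2 coding of strings by natural numbers
code : Str → ℕ
code []          = 0
code (false ∷ σ) = suc (2 * code σ)
code (true  ∷ σ) = suc (suc (2 * code σ))

W : PR 2 → Str → Set
W R σ = Σ ℕ λ t → eval R (code σ ∷ t ∷ []) ≢ 0

Π⁰₁ : PR 2 → Subset
Π⁰₁ R Y = ∀ σ → W R σ → σ ≺ Y → Data.Empty.⊥
  where import Data.Empty

-- Z is weakly (Kurtz) random: Z lies in no Π⁰₁ class of measure 0,
-- i.e. Z lies in the complement [W R] of every null Π⁰₁ class.
KurtzRandom : Cantor → Set
KurtzRandom Z = ∀ (R : PR 2) → Null (Π⁰₁ R) → ⟦ W R ⟧ Z

-- Clopen sets: a clopen subset of Cantor space is a finite union of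
-- basic cylinders; it is given by a finite list of strings C.

ClopenSet : List Str → Subset
ClopenSet C Y = Any (λ σ → σ ≺ Y) C

NonEmpty : Subset → Set
NonEmpty P = Σ Cantor P

Recurrent : ℕ → Subset → Cantor → Set
Recurrent k P Z = Σ ℕ λ n → 1 ≤ n × (∀ i → 1 ≤ i → i ≤ k → P (T^ (n * i) Z))

MultiplyRecurrent : Subset → Cantor → Set
MultiplyRecurrent P Z = ∀ k → 1 ≤ k → Recurrent k P Z

-- It suffices to find recurrence in one cylinder [τ] ⊆ P. The sequences having a prefix σ in which
-- τ occurs at n, 2n, …, kn for some n ≥ 1 form an effectively open set (the test is primitive
-- recursive in the codes of σ and n), so a Kurtz random Z lies in it once its complement is null.
-- To see that, cut the sequence into consecutive blocks, the one starting at s fixing τ at the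
-- multiples n, …, kn of n = |τ| + 1 + s and leaving every other position free. A sequence in the
-- complement matches none of the first r blocks; these are independent and each is matched with
-- probability 2 ^ -k|τ|, so the complement has measure at most (1 - 2 ^ -k|τ|) ^ r for every r,
-- which by Bernoulli's inequality is below 2 ^ -m for r = 1 + (2 ^ k|τ| - 1) 2 ^ m.

module Submission where

open import Defs
open import Algebra.Bundles using (Ring)
open import Data.Bool using (Bool; true; false; not)
open import Data.Bool.Properties using (¬-not) renaming (_≟_ to _≟ᵇ_)
open import Data.Empty using (⊥; ⊥-elim)
open import Data.Fin using (zero; suc)
open import Data.Vec using (Vec; []; _∷_)
open import Data.List using (List; []; _∷_; [_]; _++_; map; length; drop; replicate; concat)
open import Data.List.Properties using (length-++; length-map; length-replicate; drop-drop)
open import Data.List.Membership.Propositional using (find; lose)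
open import Data.List.Relation.Binary.Prefix.Heterogeneous using (Prefix; []; _∷_; uncons)
open import Data.List.Relation.Unary.All as All using (All; []; _∷_)
import Data.List.Relation.Unary.All.Properties as All
open import Data.List.Relation.Unary.Any as Any using (Any; here)
import Data.List.Relation.Unary.Any.Properties as Any
open import Data.Maybe using (Maybe; just; nothing)
open import Data.Nat using (ℕ; zero; suc; _+_; _*_; _^_; _∸_; _≤_; _<_; z≤n; s≤s; pred; NonZero)
open import Data.Nat.ListAction using (sum)
open import Data.Nat.Properties
open import Data.Nat.Tactic.RingSolver using (solve-∀)
open import Data.Product as Product using (_×_; _,_; proj₁; proj₂; uncurry)
open import Data.Product.Function.NonDependent.Propositional using (_×-⇔_)
import Data.Rational as ℚ
open ℚ using (½; 0ℚ; 1ℚ)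
import Data.Rational.Properties as ℚ
open import Data.Sum as Sum using (_⊎_; inj₁; inj₂; [_,_]′)
open import Data.Unit using (⊤; tt)
open import Function using (_∘_; id)
open import Function.Bundles using (_⇔_; mk⇔; Equivalence)
import Function.Properties.Equivalence as ⇔
open import Relation.Binary.PropositionalEquality
  using (_≡_; _≢_; refl; sym; trans; cong; cong₂; subst; _≗_; module ≡-Reasoning)
open import Relation.Nullary using (¬_; yes; no; contradiction)

open import Algebra.Properties.CommutativeSemigroup *-commutativeSemigroup using (x∙yz≈y∙xz)
open import Algebra.Properties.Semiring.Mult (Ring.semiring ℚ.+-*-ring)
  using (×-homo-+; ×-comm-*; ×-assocˡ) renaming (_×_ to _·_)

open Equivalence using (to; from)

shift : ℕ → Cantor → Cantor
shift q Y i = Y (q + i)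

_⊑_ : Str → Str → Set
_⊑_ = Prefix _≡_

≺-resp-≗ : ∀ {σ Y Y′} → Y ≗ Y′ → σ ≺ Y → σ ≺ Y′
≺-resp-≗ Y≗Y′ []≺         = []≺
≺-resp-≗ Y≗Y′ (∷≺ Y0≡b p) = ∷≺ (trans (sym (Y≗Y′ 0)) Y0≡b) (≺-resp-≗ (Y≗Y′ ∘ suc) p)

T^≗shift : ∀ q Y → T^ q Y ≗ shift q Y
T^≗shift zero    Y i = refl
T^≗shift (suc q) Y i = trans (T^≗shift q Y (suc i)) (cong Y (+-suc q i))

shift-shift : ∀ p q Y → shift q (shift p Y) ≗ shift (p + q) Y
shift-shift p q Y i = cong Y (sym (+-assoc p q i))

⊑-≺ : ∀ {τ ρ Y} → τ ⊑ ρ → ρ ≺ Y → τ ≺ Y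
⊑-≺ []          _            = []≺
⊑-≺ (refl ∷ τ⊑ρ) (∷≺ Y0≡b p) = ∷≺ Y0≡b (⊑-≺ τ⊑ρ p)

drop-≺ : ∀ q {σ Y} → σ ≺ Y → drop q σ ≺ shift q Y
drop-≺ zero    p           = p
drop-≺ (suc q) []≺         = []≺
drop-≺ (suc q) (∷≺ _ p)    = drop-≺ q p

prefix : ℕ → Cantor → Str
prefix zero    Y = []
prefix (suc l) Y = Y 0 ∷ prefix l (T Y)

prefix-≺ : ∀ l Y → prefix l Y ≺ Y
prefix-≺ zero    Y = []≺
prefix-≺ (suc l) Y = ∷≺ refl (prefix-≺ l (T Y))

≺⇒⊑-prefix : ∀ {τ} l Y → length τ ≤ l → τ ≺ Y → τ ⊑ prefix l Y
≺⇒⊑-prefix l       Y _         []≺         = []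
≺⇒⊑-prefix (suc l) Y (s≤s |τ|≤l) (∷≺ Y0≡b p) = sym Y0≡b ∷ ≺⇒⊑-prefix l (T Y) |τ|≤l p

≺-shift⇒⊑-drop-prefix : ∀ {τ} q l Y → q + length τ ≤ l → τ ≺ shift q Y → τ ⊑ drop q (prefix l Y)
≺-shift⇒⊑-drop-prefix zero    l       Y bound     p = ≺⇒⊑-prefix l Y bound p
≺-shift⇒⊑-drop-prefix (suc q) (suc l) Y (s≤s bound) p = ≺-shift⇒⊑-drop-prefix q l (T Y) bound p

-- Primitive recursive decision procedures

Accepts : ∀ {n} → PR n → Vec ℕ n → Set
Accepts f xs = eval f xs ≢ 0

comp₁ : ∀ {n} → PR 1 → PR n → PR n
comp₁ f g = comp f (g ∷ [])

comp₂ : ∀ {n} → PR 2 → PR n → PR n → PR n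
comp₂ f g h = comp f (g ∷ h ∷ [])

const : ∀ {n} → ℕ → PR n
const zero    = zer
const (suc c) = comp₁ succ (const c)

const-correct : ∀ {n} c (xs : Vec ℕ n) → eval (const c) xs ≡ c
const-correct zero    xs = refl
const-correct (suc c) xs = cong suc (const-correct c xs)

addᴾ : PR 2
addᴾ = prec (proj zero) (comp₁ succ (proj (suc zero)))

add-correct : ∀ m n → eval addᴾ (m ∷ n ∷ []) ≡ m + n
add-correct zero    n = refl
add-correct (suc m) n = cong suc (add-correct m n)

mulᴾ : PR 2
mulᴾ = prec zer (comp₂ addᴾ (proj (suc (suc zero))) (proj (suc zero)))

mul-correct : ∀ m n → eval mulᴾ (m ∷ n ∷ []) ≡ m * n
mul-correct zero    n = refl
mul-correct (suc m) n = trans (add-correct n _) (cong (n +_) (mul-correct m n))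

_∧ᴾ_ : ∀ {n} → PR n → PR n → PR n
f ∧ᴾ g = comp₂ mulᴾ f g

∧ᴾ-⇔ : ∀ {n} (f g : PR n) xs → Accepts (f ∧ᴾ g) xs ⇔ (Accepts f xs × Accepts g xs)
∧ᴾ-⇔ f g xs = mk⇔
  (λ fg≢0 → (λ f≡0 → fg≢0 (trans eq (cong (_* _) f≡0)))
          , (λ g≡0 → fg≢0 (trans eq (trans (cong (eval f xs *_) g≡0) (*-zeroʳ (eval f xs))))))
  (λ (f≢0 , g≢0) fg≡0 → [ f≢0 , g≢0 ]′ (m*n≡0⇒m≡0∨n≡0 _ (trans (sym eq) fg≡0)))
  where
  eq : eval (f ∧ᴾ g) xs ≡ eval f xs * eval g xs
  eq = mul-correct (eval f xs) (eval g xs)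

allᴾ : ∀ {n} → ℕ → (ℕ → PR n) → PR n
allᴾ zero    f = const 1
allᴾ (suc k) f = f (suc k) ∧ᴾ allᴾ k f

allᴾ-⇔ : ∀ {n} k (f : ℕ → PR n) xs →
         Accepts (allᴾ k f) xs ⇔ (∀ i → 1 ≤ i → i ≤ k → Accepts (f i) xs)
allᴾ-⇔ zero    f xs = mk⇔ (λ _ i 1≤i i≤0 → contradiction (≤-trans 1≤i i≤0) λ ()) (λ _ ())
allᴾ-⇔ (suc k) f xs = ⇔.trans (∧ᴾ-⇔ (f (suc k)) (allᴾ k f) xs) (mk⇔ split join)
  where
  split : Accepts (f (suc k)) xs × Accepts (allᴾ k f) xs → ∀ i → 1 ≤ i → i ≤ suc k → Accepts (f i) xs
  split (last , rest) i 1≤i i≤1+k with m≤n⇒m<n∨m≡n i≤1+k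
  ... | inj₁ (s≤s i≤k) = to (allᴾ-⇔ k f xs) rest i 1≤i i≤k
  ... | inj₂ refl      = last
  join : (∀ i → 1 ≤ i → i ≤ suc k → Accepts (f i) xs) → Accepts (f (suc k)) xs × Accepts (allᴾ k f) xs
  join all = all (suc k) (s≤s z≤n) ≤-refl , from (allᴾ-⇔ k f xs) (λ i 1≤i i≤k → all i 1≤i (m≤n⇒m≤1+n i≤k))

isZeroᴾ : PR 1
isZeroᴾ = prec (const 1) zer

parityᴾ : PR 1
parityᴾ = prec zer (comp₁ isZeroᴾ (proj (suc zero)))

halfᴾ : PR 1
halfᴾ = prec zer (comp₂ addᴾ (proj (suc zero)) (comp₁ parityᴾ (proj zero)))

predᴾ : PR 1
predᴾ = prec zer (proj zero)

parity half : ℕ → ℕ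
parity n = eval parityᴾ (n ∷ [])
half   n = eval halfᴾ (n ∷ [])

parity-+2 : ∀ n → parity (2 + n) ≡ parity n
parity-+2 zero    = refl
parity-+2 (suc n) = cong (λ p → eval isZeroᴾ (p ∷ [])) (parity-+2 n)

parity-+1 : ∀ n → parity n + parity (suc n) ≡ 1
parity-+1 zero    = refl
parity-+1 (suc n) = begin
  parity (suc n) + parity (2 + n) ≡⟨ cong (parity (suc n) +_) (parity-+2 n) ⟩
  parity (suc n) + parity n       ≡⟨ +-comm (parity (suc n)) (parity n) ⟩
  parity n + parity (suc n)       ≡⟨ parity-+1 n ⟩
  1                               ∎
  where open ≡-Reasoning

half-suc : ∀ n → half (suc n) ≡ half n + parity n
half-suc n = add-correct (half n) (parity n)

half-+2 : ∀ n → half (2 + n) ≡ suc (half n)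
half-+2 n = begin
  half (2 + n)                              ≡⟨ half-suc (suc n) ⟩
  half (suc n) + parity (suc n)             ≡⟨ cong (_+ parity (suc n)) (half-suc n) ⟩
  half n + parity n + parity (suc n)        ≡⟨ +-assoc (half n) (parity n) (parity (suc n)) ⟩
  half n + (parity n + parity (suc n))      ≡⟨ cong (half n +_) (parity-+1 n) ⟩
  half n + 1                                ≡⟨ +-comm (half n) 1 ⟩
  suc (half n)                              ∎
  where open ≡-Reasoning

parity-even : ∀ c → parity (2 * c) ≡ 0
parity-even zero    = refl
parity-even (suc c) = trans (cong parity (*-suc 2 c)) (trans (parity-+2 (2 * c)) (parity-even c))

parity-odd : ∀ c → parity (1 + 2 * c) ≡ 1
parity-odd c = cong (λ p → eval isZeroᴾ (p ∷ [])) (parity-even c)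

half-even : ∀ c → half (2 * c) ≡ c
half-even zero    = refl
half-even (suc c) = trans (cong half (*-suc 2 c)) (trans (half-+2 (2 * c)) (cong suc (half-even c)))

half-odd : ∀ c → half (1 + 2 * c) ≡ c
half-odd c = begin
  half (1 + 2 * c)             ≡⟨ half-suc (2 * c) ⟩
  half (2 * c) + parity (2 * c) ≡⟨ cong₂ _+_ (half-even c) (parity-even c) ⟩
  c + 0                        ≡⟨ +-identityʳ c ⟩
  c                            ∎
  where open ≡-Reasoning

-- Codes satisfy code (b ∷ σ) = 1 + b + 2 · code σ, so the tail is read off as ⌊(x ∸ 1) / 2⌋
-- and the head from the parity of x (or of x ∸ 1).
tailᴾ : PR 1
tailᴾ = comp₁ halfᴾ predᴾ

tail-code : ∀ σ → eval tailᴾ (code σ ∷ []) ≡ code (drop 1 σ)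
tail-code []          = refl
tail-code (false ∷ σ) = half-even (code σ)
tail-code (true  ∷ σ) = half-odd (code σ)

headIsᴾ : Bool → PR 1
headIsᴾ false = parityᴾ
headIsᴾ true  = comp₁ parityᴾ predᴾ

headIs-[] : ∀ b → ¬ Accepts (headIsᴾ b) (code [] ∷ [])
headIs-[] false 0≢0 = 0≢0 refl
headIs-[] true  0≢0 = 0≢0 refl

headIs-⇔ : ∀ b b′ ρ → Accepts (headIsᴾ b) (code (b′ ∷ ρ) ∷ []) ⇔ b ≡ b′
headIs-⇔ false false ρ = mk⇔ (λ _ → refl) (λ _ odd≡0 → 1+n≢0 (trans (sym (parity-odd (code ρ))) odd≡0))
headIs-⇔ false true  ρ = mk⇔ (λ acc → contradiction (trans (parity-+2 (2 * code ρ)) (parity-even (code ρ))) acc) λ ()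
headIs-⇔ true  false ρ = mk⇔ (λ acc → contradiction (parity-even (code ρ)) acc) λ ()
headIs-⇔ true  true  ρ = mk⇔ (λ _ → refl) (λ _ odd≡0 → 1+n≢0 (trans (sym (parity-odd (code ρ))) odd≡0))

prefixOfᴾ : Str → PR 1
prefixOfᴾ []      = const 1
prefixOfᴾ (b ∷ τ) = headIsᴾ b ∧ᴾ comp₁ (prefixOfᴾ τ) tailᴾ

prefixOf-⇔ : ∀ τ ρ {x} → x ≡ code ρ → Accepts (prefixOfᴾ τ) (x ∷ []) ⇔ τ ⊑ ρ
prefixOf-⇔ []      ρ        _    = mk⇔ (λ _ → []) (λ _ ())
prefixOf-⇔ (b ∷ τ) []       refl = mk⇔ (⊥-elim ∘ headIs-[] b ∘ proj₁ ∘ to (∧ᴾ-⇔ (headIsᴾ b) (comp₁ (prefixOfᴾ τ) tailᴾ) (0 ∷ []))) λ ()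
prefixOf-⇔ (b ∷ τ) (b′ ∷ ρ) refl =
  ⇔.trans (∧ᴾ-⇔ (headIsᴾ b) (comp₁ (prefixOfᴾ τ) tailᴾ) (code (b′ ∷ ρ) ∷ []))
    (⇔.trans (headIs-⇔ b b′ ρ ×-⇔ prefixOf-⇔ τ ρ (tail-code (b′ ∷ ρ)))
             (mk⇔ (uncurry _∷_) uncons))

dropᴾ : PR 2
dropᴾ = prec (proj zero) (comp₁ tailᴾ (proj (suc zero)))

drop-code : ∀ p σ → eval dropᴾ (p ∷ code σ ∷ []) ≡ code (drop p σ)
drop-code zero    σ = refl
drop-code (suc p) σ = begin
  eval tailᴾ (eval dropᴾ (p ∷ code σ ∷ []) ∷ []) ≡⟨ cong (λ x → eval tailᴾ (x ∷ [])) (drop-code p σ) ⟩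
  eval tailᴾ (code (drop p σ) ∷ [])              ≡⟨ tail-code (drop p σ) ⟩
  code (drop 1 (drop p σ))                       ≡⟨ cong code (drop-drop p 1 σ) ⟩
  code (drop (p + 1) σ)                          ≡⟨ cong (λ q → code (drop q σ)) (+-comm p 1) ⟩
  code (drop (suc p) σ)                          ∎
  where open ≡-Reasoning

OccursAtMultiples : Str → ℕ → ℕ → Str → Set
OccursAtMultiples τ n k σ = ∀ i → 1 ≤ i → i ≤ k → τ ⊑ drop (n * i) σ

-- Accepts (code σ , n) iff τ ⊑ drop (n * i) σ.
occursAtᴾ : Str → ℕ → PR 2
occursAtᴾ τ i = comp₁ (prefixOfᴾ τ) (comp₂ dropᴾ (comp₂ mulᴾ (proj (suc zero)) (const i)) (proj zero))

recurrenceᴾ : Str → ℕ → PR 2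
recurrenceᴾ τ k = proj (suc zero) ∧ᴾ allᴾ k (occursAtᴾ τ)

recurrenceᴾ-⇔ : ∀ τ k σ n → Accepts (recurrenceᴾ τ k) (code σ ∷ n ∷ []) ⇔ (1 ≤ n × OccursAtMultiples τ n k σ)
recurrenceᴾ-⇔ τ k σ n =
  ⇔.trans (∧ᴾ-⇔ (proj (suc zero)) (allᴾ k (occursAtᴾ τ)) xs)
          (mk⇔ n≢0⇒n>0 n>0⇒n≢0 ×-⇔ ⇔.trans (allᴾ-⇔ k (occursAtᴾ τ) xs) (mk⇔ occurs accepts))
  where
  xs : Vec ℕ 2
  xs = code σ ∷ n ∷ []
  position : ∀ i → eval dropᴾ (eval mulᴾ (n ∷ eval (const i) (code σ ∷ n ∷ []) ∷ []) ∷ code σ ∷ [])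
                   ≡ code (drop (n * i) σ)
  position i rewrite const-correct i (code σ ∷ n ∷ []) | mul-correct n i = drop-code (n * i) σ
  occurs : (∀ i → 1 ≤ i → i ≤ k → Accepts (occursAtᴾ τ i) xs) → OccursAtMultiples τ n k σ
  occurs acc i 1≤i i≤k = to (prefixOf-⇔ τ (drop (n * i) σ) (position i)) (acc i 1≤i i≤k)
  accepts : OccursAtMultiples τ n k σ → ∀ i → 1 ≤ i → i ≤ k → Accepts (occursAtᴾ τ i) xs
  accepts occ i 1≤i i≤k = from (prefixOf-⇔ τ (drop (n * i) σ) (position i)) (occ i 1≤i i≤k)

-- Measure of covers by strings of equal length

AllOfLength : ℕ → List Str → Set
AllOfLength ℓ = All (λ σ → length σ ≡ ℓ)

weight-uniform : ∀ {ℓ S} → AllOfLength ℓ S → weight S ≡ length S · ½^ ℓ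
weight-uniform []           = refl
weight-uniform {S = σ ∷ _} (refl ∷ |S|) = cong (½^ (length σ) ℚ.+_) (weight-uniform |S|)

½^-nonNeg : ∀ m → 0ℚ ℚ.≤ ½^ m
½^-nonNeg zero    = ℚ.nonNegative⁻¹ 1ℚ
½^-nonNeg (suc m) = ℚ.*-monoˡ-≤-nonNeg ½ (½^-nonNeg m)

·-nonNeg : ∀ {x} n → 0ℚ ℚ.≤ x → 0ℚ ℚ.≤ n · x
·-nonNeg zero    0≤x = ℚ.≤-refl
·-nonNeg (suc n) 0≤x = ℚ.+-mono-≤ 0≤x (·-nonNeg n 0≤x)

·-monoˡ-≤ : ∀ {x c d} → 0ℚ ℚ.≤ x → c ≤ d → c · x ℚ.≤ d · x
·-monoˡ-≤ {x} {c} {d} 0≤x c≤d = begin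
  c · x                 ≡⟨ sym (ℚ.+-identityʳ (c · x)) ⟩
  c · x ℚ.+ 0ℚ          ≤⟨ ℚ.+-monoʳ-≤ (c · x) (·-nonNeg (d ∸ c) 0≤x) ⟩
  c · x ℚ.+ (d ∸ c) · x ≡⟨ sym (×-homo-+ x c (d ∸ c)) ⟩
  (c + (d ∸ c)) · x     ≡⟨ cong (_· x) (m+[n∸m]≡n c≤d) ⟩
  d · x                 ∎
  where open ℚ.≤-Reasoning

2^ℓ·½^ℓ≡1 : ∀ ℓ → (2 ^ ℓ) · ½^ ℓ ≡ 1ℚ
2^ℓ·½^ℓ≡1 zero    = refl
2^ℓ·½^ℓ≡1 (suc ℓ) = begin
  (2 * 2 ^ ℓ) · (½ ℚ.* ½^ ℓ)     ≡⟨ sym (×-comm-* (2 * 2 ^ ℓ) ½ (½^ ℓ)) ⟩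
  ½ ℚ.* ((2 * 2 ^ ℓ) · ½^ ℓ)     ≡⟨ cong (½ ℚ.*_) (sym (×-assocˡ (½^ ℓ) 2 (2 ^ ℓ))) ⟩
  ½ ℚ.* (2 · ((2 ^ ℓ) · ½^ ℓ))   ≡⟨ cong (λ x → ½ ℚ.* (2 · x)) (2^ℓ·½^ℓ≡1 ℓ) ⟩
  ½ ℚ.* (2 · 1ℚ)                 ≡⟨⟩
  1ℚ                             ∎
  where open ≡-Reasoning

·½^-≤ : ∀ c m ℓ → c * 2 ^ m ≤ 2 ^ ℓ → c · ½^ ℓ ℚ.≤ ½^ m
·½^-≤ c zero ℓ c≤2^ℓ = begin
  c · ½^ ℓ       ≤⟨ ·-monoˡ-≤ (½^-nonNeg ℓ) (subst (_≤ 2 ^ ℓ) (*-identityʳ c) c≤2^ℓ) ⟩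
  (2 ^ ℓ) · ½^ ℓ ≡⟨ 2^ℓ·½^ℓ≡1 ℓ ⟩
  1ℚ             ∎
  where open ℚ.≤-Reasoning
·½^-≤ zero    (suc m) zero    _  = ½^-nonNeg (suc m)
·½^-≤ (suc c) (suc m) zero    le =
  contradiction (≤-trans (*-monoʳ-≤ 2 (m^n>0 2 m)) (≤-trans (m≤m+n _ _) le)) λ { (s≤s ()) }
·½^-≤ c       (suc m) (suc ℓ) le = begin
  c · (½ ℚ.* ½^ ℓ) ≡⟨ sym (×-comm-* c ½ (½^ ℓ)) ⟩
  ½ ℚ.* (c · ½^ ℓ) ≤⟨ ℚ.*-monoˡ-≤-nonNeg ½ (·½^-≤ c m ℓ c*2^m≤2^ℓ) ⟩
  ½ ℚ.* ½^ m       ∎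
  where
  open ℚ.≤-Reasoning
  c*2^m≤2^ℓ : c * 2 ^ m ≤ 2 ^ ℓ
  c*2^m≤2^ℓ = *-cancelˡ-≤ 2 (subst (_≤ 2 * 2 ^ ℓ) (x∙yz≈y∙xz c 2 (2 ^ m)) le)

record UniformCover (P : Subset) (m : ℕ) : Set where
  field
    ℓ       : ℕ
    strings : List Str
    covers  : ∀ Y → P Y → Any (_≺ Y) strings
    lengths : AllOfLength ℓ strings
    small   : length strings * 2 ^ m ≤ 2 ^ ℓ

Null-from-uniform-covers : ∀ {P} → (∀ m → UniformCover P m) → Null P
Null-from-uniform-covers covers m = strings , covers′ ,
  subst (ℚ._≤ ½^ m) (sym (weight-uniform lengths)) (·½^-≤ (length strings) m ℓ small)
  where open UniformCover (covers m) renaming (covers to covers′)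

-- Patterns: cylinders with some positions left free

Pattern : Set
Pattern = List (Maybe Bool)

Matches : Pattern → Cantor → Set
Matches []            Y = ⊤
Matches (nothing ∷ D) Y = Matches D (T Y)
Matches (just b ∷ D)  Y = Y 0 ≡ b × Matches D (T Y)

#free #fixed : Pattern → ℕ
#free []            = 0
#free (nothing ∷ D) = suc (#free D)
#free (just _ ∷ D)  = #free D
#fixed []            = 0
#fixed (nothing ∷ D) = #fixed D
#fixed (just _ ∷ D)  = suc (#fixed D)

length≡#free+#fixed : ∀ D → length D ≡ #free D + #fixed D
length≡#free+#fixed []            = refl
length≡#free+#fixed (nothing ∷ D) = cong suc (length≡#free+#fixed D)
length≡#free+#fixed (just _ ∷ D)  = trans (cong suc (length≡#free+#fixed D)) (sym (+-suc (#free D) (#fixed D)))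

#fixed-++ : ∀ A B → #fixed (A ++ B) ≡ #fixed A + #fixed B
#fixed-++ []            B = refl
#fixed-++ (nothing ∷ A) B = #fixed-++ A B
#fixed-++ (just _ ∷ A)  B = cong suc (#fixed-++ A B)

#fixed-map-just : ∀ τ → #fixed (map just τ) ≡ length τ
#fixed-map-just []      = refl
#fixed-map-just (_ ∷ τ) = cong suc (#fixed-map-just τ)

#fixed-replicate-nothing : ∀ n → #fixed (replicate n nothing) ≡ 0
#fixed-replicate-nothing zero    = refl
#fixed-replicate-nothing (suc n) = #fixed-replicate-nothing n

#fixed-concat-replicate : ∀ k P → #fixed (concat (replicate k P)) ≡ k * #fixed P
#fixed-concat-replicate zero    P = refl
#fixed-concat-replicate (suc k) P = trans (#fixed-++ P _) (cong (#fixed P +_) (#fixed-concat-replicate k P))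

length-concat-replicate : ∀ {A : Set} k (P : List A) → length (concat (replicate k P)) ≡ k * length P
length-concat-replicate zero    P = refl
length-concat-replicate (suc k) P = trans (length-++ P) (cong (length P +_) (length-concat-replicate k P))

2^length : ∀ D → 2 ^ length D ≡ 2 ^ #free D * 2 ^ #fixed D
2^length D = trans (cong (2 ^_) (length≡#free+#fixed D)) (^-distribˡ-+-* 2 (#free D) (#fixed D))

Matches-resp-≗ : ∀ D {Y Y′} → Y ≗ Y′ → Matches D Y → Matches D Y′
Matches-resp-≗ []            Y≗Y′ _          = tt
Matches-resp-≗ (nothing ∷ D) Y≗Y′ m          = Matches-resp-≗ D (Y≗Y′ ∘ suc) m
Matches-resp-≗ (just b ∷ D)  Y≗Y′ (Y0≡b , m) = trans (sym (Y≗Y′ 0)) Y0≡b , Matches-resp-≗ D (Y≗Y′ ∘ suc) m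

Matches-++ : ∀ A {B} Y → Matches (A ++ B) Y → Matches A Y × Matches B (shift (length A) Y)
Matches-++ []            Y m          = tt , m
Matches-++ (nothing ∷ A) Y m          = Matches-++ A (T Y) m
Matches-++ (just b ∷ A)  Y (Y0≡b , m) = Product.map₁ (Y0≡b ,_) (Matches-++ A (T Y) m)

Matches-just : ∀ τ Y → Matches (map just τ) Y → τ ≺ Y
Matches-just []      Y _          = []≺
Matches-just (b ∷ τ) Y (Y0≡b , m) = ∷≺ Y0≡b (Matches-just τ (T Y) m)

Matches-concat-replicate : ∀ k P Y → Matches (concat (replicate k P)) Y →
                           ∀ i → i < k → Matches P (shift (i * length P) Y)
Matches-concat-replicate (suc k) P Y m zero    _         = proj₁ (Matches-++ P Y m)
Matches-concat-replicate (suc k) P Y m (suc i) (s≤s i<k) =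
  Matches-resp-≗ P (shift-shift (length P) (i * length P) Y)
    (Matches-concat-replicate k P (shift (length P) Y) (proj₂ (Matches-++ P Y m)) i i<k)

prepend : List Str → List Str
prepend S = map (false ∷_) S ++ map (true ∷_) S

completions : ℕ → List Str → List Str
completions zero    K = K
completions (suc n) K = prepend (completions n K)

-- All strings of length |D| that do not match D, each followed by each string of K.
avoiding : Pattern → List Str → List Str
avoiding []            K = []
avoiding (nothing ∷ D) K = prepend (avoiding D K)
avoiding (just b ∷ D)  K = map (b ∷_) (avoiding D K) ++ map (not b ∷_) (completions (length D) K)

∷-cover : ∀ {b S} Y → Y 0 ≡ b → Any (_≺ T Y) S → Any (_≺ Y) (map (b ∷_) S)
∷-cover Y Y0≡b = Any.map⁺ ∘ Any.map (∷≺ Y0≡b)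

prepend-cover : ∀ {S} Y → Any (_≺ T Y) S → Any (_≺ Y) (prepend S)
prepend-cover Y a with Y 0 in Y0≡b
... | false = Any.++⁺ˡ (∷-cover Y Y0≡b a)
... | true  = Any.++⁺ʳ _ (∷-cover Y Y0≡b a)

completions-cover : ∀ {K} n Y → Any (_≺ shift n Y) K → Any (_≺ Y) (completions n K)
completions-cover zero    Y a = a
completions-cover (suc n) Y a = prepend-cover Y (completions-cover n (T Y) a)

avoiding-cover : ∀ {K} D Y → Any (_≺ shift (length D) Y) K → Matches D Y ⊎ Any (_≺ Y) (avoiding D K)
avoiding-cover []            Y a = inj₁ tt
avoiding-cover (nothing ∷ D) Y a = Sum.map₂ (prepend-cover Y) (avoiding-cover D (T Y) a)
avoiding-cover (just b ∷ D)  Y a with Y 0 ≟ᵇ b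
... | yes Y0≡b = Sum.map (Y0≡b ,_) (Any.++⁺ˡ ∘ ∷-cover Y Y0≡b) (avoiding-cover D (T Y) a)
... | no  Y0≢b = inj₂ (Any.++⁺ʳ _ (∷-cover Y (¬-not Y0≢b) (completions-cover (length D) (T Y) a)))

length-prepend : ∀ S → length (prepend S) ≡ 2 * length S
length-prepend S = begin
  length (map (false ∷_) S ++ map (true ∷_) S)        ≡⟨ length-++ (map (false ∷_) S) ⟩
  length (map (false ∷_) S) + length (map (true ∷_) S) ≡⟨ cong₂ _+_ (length-map _ S) (length-map _ S) ⟩
  length S + length S                                 ≡⟨ cong (length S +_) (sym (+-identityʳ (length S))) ⟩
  2 * length S                                        ∎
  where open ≡-Reasoning

length-completions : ∀ n K → length (completions n K) ≡ 2 ^ n * length K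
length-completions zero    K = sym (+-identityʳ (length K))
length-completions (suc n) K = begin
  length (prepend (completions n K)) ≡⟨ length-prepend (completions n K) ⟩
  2 * length (completions n K)       ≡⟨ cong (2 *_) (length-completions n K) ⟩
  2 * (2 ^ n * length K)             ≡⟨ sym (*-assoc 2 (2 ^ n) (length K)) ⟩
  2 ^ suc n * length K               ∎
  where open ≡-Reasoning

-- Exactly 2 ^ #free D strings of length |D| match D.
length-avoiding : ∀ D K → length (avoiding D K) + 2 ^ #free D * length K ≡ 2 ^ length D * length K
length-avoiding []            K = refl
length-avoiding (nothing ∷ D) K = begin
  length (prepend A) + 2 * F * |K| ≡⟨ cong₂ _+_ (length-prepend A) (*-assoc 2 F |K|) ⟩
  2 * length A + 2 * (F * |K|)     ≡⟨ sym (*-distribˡ-+ 2 (length A) (F * |K|)) ⟩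
  2 * (length A + F * |K|)         ≡⟨ cong (2 *_) (length-avoiding D K) ⟩
  2 * (2 ^ length D * |K|)         ≡⟨ sym (*-assoc 2 (2 ^ length D) |K|) ⟩
  2 * 2 ^ length D * |K|           ∎
  where
  open ≡-Reasoning
  A : List Str
  A = avoiding D K
  F |K| : ℕ
  F = 2 ^ #free D
  |K| = length K
length-avoiding (just b ∷ D)  K = begin
  length (map (b ∷_) A ++ map (not b ∷_) C) + M           ≡⟨ cong (_+ M) (length-++ (map (b ∷_) A)) ⟩
  length (map (b ∷_) A) + length (map (not b ∷_) C) + M   ≡⟨ cong (_+ M) (cong₂ _+_ (length-map _ A) (length-map _ C)) ⟩
  length A + length C + M                                 ≡⟨ +-rearrange (length A) (length C) M ⟩
  (length A + M) + length C                               ≡⟨ cong₂ _+_ (length-avoiding D K) (length-completions (length D) K) ⟩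
  N + N                                                   ≡⟨ cong (N +_) (sym (+-identityʳ N)) ⟩
  2 * N                                                   ≡⟨ sym (*-assoc 2 (2 ^ length D) (length K)) ⟩
  2 * 2 ^ length D * length K                             ∎
  where
  open ≡-Reasoning
  A C : List Str
  A = avoiding D K
  C = completions (length D) K
  M N : ℕ
  M = 2 ^ #free D * length K
  N = 2 ^ length D * length K
  +-rearrange : ∀ a c m → a + c + m ≡ (a + m) + c
  +-rearrange = solve-∀

prepend-lengths : ∀ {ℓ S} → AllOfLength ℓ S → AllOfLength (suc ℓ) (prepend S)
prepend-lengths |S| = All.++⁺ (All.map⁺ (All.map (cong suc) |S|)) (All.map⁺ (All.map (cong suc) |S|))

completions-lengths : ∀ {ℓ K} n → AllOfLength ℓ K → AllOfLength (n + ℓ) (completions n K)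
completions-lengths zero    |K| = |K|
completions-lengths (suc n) |K| = prepend-lengths (completions-lengths n |K|)

avoiding-lengths : ∀ {ℓ K} D → AllOfLength ℓ K → AllOfLength (length D + ℓ) (avoiding D K)
avoiding-lengths []            |K| = []
avoiding-lengths (nothing ∷ D) |K| = prepend-lengths (avoiding-lengths D |K|)
avoiding-lengths (just b ∷ D)  |K| =
  All.++⁺ (All.map⁺ (All.map (cong suc) (avoiding-lengths D |K|)))
          (All.map⁺ (All.map (cong suc) (completions-lengths (length D) |K|)))

MatchesSomeBlock : List Pattern → ℕ → Cantor → Set
MatchesSomeBlock []       p Y = ⊥
MatchesSomeBlock (D ∷ Ds) p Y = Matches D (shift p Y) ⊎ MatchesSomeBlock Ds (p + length D) Y

avoidingAll : List Pattern → List Str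
avoidingAll []       = [ [] ]
avoidingAll (D ∷ Ds) = avoiding D (avoidingAll Ds)

avoidingAll-cover : ∀ Ds p Y → MatchesSomeBlock Ds p Y ⊎ Any (_≺ shift p Y) (avoidingAll Ds)
avoidingAll-cover []       p Y = inj₂ (here []≺)
avoidingAll-cover (D ∷ Ds) p Y with avoidingAll-cover Ds (p + length D) Y
... | inj₁ later = inj₁ (inj₂ later)
... | inj₂ rest  = Sum.map₁ inj₁ (avoiding-cover D (shift p Y) (Any.map (≺-resp-≗ (sym ∘ shift-shift p (length D) Y)) rest))

avoidingAll-lengths : ∀ Ds → AllOfLength (sum (map length Ds)) (avoidingAll Ds)
avoidingAll-lengths []       = refl ∷ []
avoidingAll-lengths (D ∷ Ds) = avoiding-lengths D (avoidingAll-lengths Ds)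

length-avoiding-fixed : ∀ {b} D K → 2 ^ #fixed D ≡ suc b → length (avoiding D K) ≡ 2 ^ #free D * b * length K
length-avoiding-fixed {b} D K 2^fixed≡1+b = +-cancelʳ-≡ (2 ^ #free D * length K) _ _ (begin
  length (avoiding D K) + F * length K   ≡⟨ length-avoiding D K ⟩
  2 ^ length D * length K                ≡⟨ cong (_* length K) (2^length D) ⟩
  F * 2 ^ #fixed D * length K            ≡⟨ cong (λ x → F * x * length K) 2^fixed≡1+b ⟩
  F * suc b * length K                   ≡⟨ distrib F b (length K) ⟩
  F * b * length K + F * length K        ∎)
  where
  open ≡-Reasoning
  F : ℕ
  F = 2 ^ #free D
  distrib : ∀ f b k → f * suc b * k ≡ f * b * k + f * k
  distrib = solve-∀

-- With a proportion b / (1 + b) of the strings avoiding each block, r blocks leave (b / (1 + b)) ^ r.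
length-avoidingAll : ∀ {b} Ds → All (λ D → 2 ^ #fixed D ≡ suc b) Ds →
  length (avoidingAll Ds) * suc b ^ length Ds ≡ 2 ^ sum (map length Ds) * b ^ length Ds
length-avoidingAll     []       []                  = refl
length-avoidingAll {b} (D ∷ Ds) (2^fixed≡1+b ∷ Ds-fixed) = begin
  length (avoiding D K) * (suc b * suc b ^ r)  ≡⟨ cong (_* (suc b * suc b ^ r)) (length-avoiding-fixed D K 2^fixed≡1+b) ⟩
  F * b * length K * (suc b * suc b ^ r)      ≡⟨ regroup₁ F b (length K) (suc b ^ r) ⟩
  F * suc b * b * (length K * suc b ^ r)      ≡⟨ cong₂ (λ x y → x * b * y) (sym 2^length≡) (length-avoidingAll Ds Ds-fixed) ⟩
  2 ^ length D * b * (2 ^ ℓ * b ^ r)          ≡⟨ regroup₂ (2 ^ length D) b (2 ^ ℓ) (b ^ r) ⟩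
  2 ^ length D * 2 ^ ℓ * (b * b ^ r)          ≡⟨ cong (_* (b * b ^ r)) (sym (^-distribˡ-+-* 2 (length D) ℓ)) ⟩
  2 ^ (length D + ℓ) * (b * b ^ r)            ∎
  where
  open ≡-Reasoning
  K : List Str
  K = avoidingAll Ds
  F r ℓ : ℕ
  F = 2 ^ #free D
  r = length Ds
  ℓ = sum (map length Ds)
  2^length≡ : 2 ^ length D ≡ F * suc b
  2^length≡ = trans (2^length D) (cong (F *_) 2^fixed≡1+b)
  regroup₁ : ∀ f b k q → f * b * k * (suc b * q) ≡ f * suc b * b * (k * q)
  regroup₁ = solve-∀
  regroup₂ : ∀ x b y q → x * b * (y * q) ≡ x * y * (b * q)
  regroup₂ = solve-∀

bernoulli : ∀ b n → b ^ suc n + suc n * b ^ n ≤ suc b ^ suc n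
bernoulli b zero    = ≤-reflexive (base b)
  where
  base : ∀ b → b * 1 + 1 * 1 ≡ suc b * 1
  base = solve-∀
bernoulli b (suc n) = begin
  b ^ suc (suc n) + suc (suc n) * b ^ suc n                ≤⟨ m≤m+n _ (suc n * b ^ n) ⟩
  b ^ suc (suc n) + suc (suc n) * b ^ suc n + suc n * b ^ n ≡⟨ expand b n (b ^ n) ⟩
  suc b * (b ^ suc n + suc n * b ^ n)                      ≤⟨ *-monoʳ-≤ (suc b) (bernoulli b n) ⟩
  suc b * suc b ^ suc n                                    ∎
  where
  open ≤-Reasoning
  expand : ∀ b n x → b * (b * x) + suc (suc n) * (b * x) + suc n * x ≡ suc b * (b * x + suc n * x)
  expand = solve-∀

[b/1+b]^r≤½^m : ∀ b m → let r = suc (b * 2 ^ m) in 2 ^ m * b ^ r ≤ suc b ^ r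
[b/1+b]^r≤½^m b m = begin
  2 ^ m * (b * b ^ n)    ≡⟨ regroup (2 ^ m) b (b ^ n) ⟩
  n * b ^ n              ≤⟨ *-monoˡ-≤ (b ^ n) (n≤1+n n) ⟩
  suc n * b ^ n          ≤⟨ m≤n+m _ (b ^ suc n) ⟩
  b ^ suc n + suc n * b ^ n ≤⟨ bernoulli b n ⟩
  suc b ^ suc n          ∎
  where
  open ≤-Reasoning
  n : ℕ
  n = b * 2 ^ m
  regroup : ∀ x b y → x * (b * y) ≡ b * x * y
  regroup = solve-∀

cross-multiply : ∀ c a m B x .{{_ : NonZero B}} → c * B ≡ a * x → m * x ≤ B → c * m ≤ a
cross-multiply c a m B x cB≡ax mx≤B = *-cancelʳ-≤ (c * m) a B (begin
  c * m * B    ≡⟨ regroup c m B ⟩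
  m * (c * B)  ≡⟨ cong (m *_) cB≡ax ⟩
  m * (a * x)  ≡⟨ x∙yz≈y∙xz m a x ⟩
  a * (m * x)  ≤⟨ *-monoʳ-≤ a mx≤B ⟩
  a * B        ∎)
  where
  open ≤-Reasoning
  regroup : ∀ c m B → c * m * B ≡ m * (c * B)
  regroup = solve-∀

-- Blocks forcing recurrence

module _ (τ : Str) (k : ℕ) where

  private
    L : ℕ
    L = length τ

  period : ℕ → Pattern
  period s = map just τ ++ replicate (suc s) nothing

  -- Matching the block at position s puts τ at positions n, 2n, …, kn for n = L + 1 + s.
  block : ℕ → Pattern
  block s = replicate (suc L) nothing ++ concat (replicate k (period s))

  blocks : ℕ → ℕ → List Pattern
  blocks s zero    = []
  blocks s (suc r) = block s ∷ blocks (s + length (block s)) r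

  length-period : ∀ s → length (period s) ≡ L + suc s
  length-period s = trans (length-++ (map just τ)) (cong₂ _+_ (length-map just τ) (length-replicate (suc s)))

  length-block : ∀ s → length (block s) ≡ suc L + k * (L + suc s)
  length-block s = trans (length-++ (replicate (suc L) nothing))
    (cong₂ _+_ (length-replicate (suc L)) (trans (length-concat-replicate k (period s)) (cong (k *_) (length-period s))))

  #fixed-period : ∀ s → #fixed (period s) ≡ L
  #fixed-period s = trans (#fixed-++ (map just τ) _)
    (trans (cong₂ _+_ (#fixed-map-just τ) (#fixed-replicate-nothing (suc s))) (+-identityʳ L))

  #fixed-block : ∀ s → #fixed (block s) ≡ k * L
  #fixed-block s = trans (#fixed-++ (replicate (suc L) nothing) _)
    (cong₂ _+_ (#fixed-replicate-nothing (suc L)) (trans (#fixed-concat-replicate k (period s)) (cong (k *_) (#fixed-period s))))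

  block-occurrences : ∀ s Y → Matches (block s) (shift s Y) → ∀ i → 1 ≤ i → i ≤ k → τ ≺ shift ((L + suc s) * i) Y
  block-occurrences s Y m (suc i) _ i<k =
    ≺-resp-≗ position
      (Matches-just τ _ (proj₁ (Matches-++ (map just τ) _
        (Matches-concat-replicate k (period s) _ (proj₂ (Matches-++ (replicate (suc L) nothing) (shift s Y) m)) i i<k))))
    where
    position : ∀ j → Y (s + (length (replicate (suc L) nothing) + (i * length (period s) + j))) ≡ Y ((L + suc s) * suc i + j)
    position j = cong Y (trans (cong₂ (λ a p → s + (a + (i * p + j))) (length-replicate (suc L)) (length-period s))
                               (arith L s i j))
      where
      arith : ∀ L s i j → s + (suc L + (i * (L + suc s) + j)) ≡ (L + suc s) * suc i + j
      arith = solve-∀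

  block-recurrence : ∀ s Y → Matches (block s) (shift s Y) → OccursAtMultiples τ (L + suc s) k (prefix (s + length (block s)) Y)
  block-recurrence s Y m i 1≤i i≤k =
    ≺-shift⇒⊑-drop-prefix ((L + suc s) * i) (s + length (block s)) Y within (block-occurrences s Y m i 1≤i i≤k)
    where
    within : (L + suc s) * i + L ≤ s + length (block s)
    within = begin
      (L + suc s) * i + L             ≤⟨ +-monoˡ-≤ L (*-monoʳ-≤ (L + suc s) i≤k) ⟩
      (L + suc s) * k + L             ≡⟨ +-comm ((L + suc s) * k) L ⟩
      L + (L + suc s) * k             ≡⟨ cong (L +_) (*-comm (L + suc s) k) ⟩
      L + k * (L + suc s)             ≤⟨ n≤1+n _ ⟩
      suc L + k * (L + suc s)         ≤⟨ m≤n+m _ s ⟩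
      s + (suc L + k * (L + suc s))   ≡⟨ cong (s +_) (sym (length-block s)) ⟩
      s + length (block s)            ∎
      where open ≤-Reasoning

  length-blocks : ∀ s r → length (blocks s r) ≡ r
  length-blocks s zero    = refl
  length-blocks s (suc r) = cong suc (length-blocks (s + length (block s)) r)

  blocks-fixed : ∀ s r → All (λ D → #fixed D ≡ k * L) (blocks s r)
  blocks-fixed s zero    = []
  blocks-fixed s (suc r) = #fixed-block s ∷ blocks-fixed (s + length (block s)) r

  no-block-matches : ∀ {Y} → Π⁰₁ (recurrenceᴾ τ k) Y → ∀ s r → ¬ MatchesSomeBlock (blocks s r) s Y
  no-block-matches {Y} avoids s (suc r) (inj₁ m) = avoids (prefix l Y) (L + suc s , accepted) (prefix-≺ l Y)
    where
    l : ℕ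
    l = s + length (block s)
    1≤n : 1 ≤ L + suc s
    1≤n = ≤-trans (s≤s z≤n) (m≤n+m (suc s) L)
    accepted : Accepts (recurrenceᴾ τ k) (code (prefix l Y) ∷ L + suc s ∷ [])
    accepted = from (recurrenceᴾ-⇔ τ k (prefix l Y) (L + suc s)) (1≤n , block-recurrence s Y m)
  no-block-matches avoids s (suc r) (inj₂ later) = no-block-matches avoids (s + length (block s)) r later

  block-cover : ∀ m → UniformCover (Π⁰₁ (recurrenceᴾ τ k)) m
  block-cover m = record
    { ℓ       = sum (map length Ds)
    ; strings = avoidingAll Ds
    ; covers  = λ Y avoids → [ ⊥-elim ∘ no-block-matches avoids 0 r , id ]′ (avoidingAll-cover Ds 0 Y)
    ; lengths = avoidingAll-lengths Ds
    ; small   = cross-multiply (length (avoidingAll Ds)) (2 ^ sum (map length Ds)) (2 ^ m) (suc b ^ r) (b ^ r)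
                  {{m^n≢0 (suc b) r}} count ([b/1+b]^r≤½^m b m)
    }
    where
    b r : ℕ
    b = pred (2 ^ (k * L))
    r = suc (b * 2 ^ m)
    Ds : List Pattern
    Ds = blocks 0 r
    2^fixed≡1+b : All (λ D → 2 ^ #fixed D ≡ suc b) Ds
    2^fixed≡1+b = All.map (λ fixed≡kL → trans (cong (2 ^_) fixed≡kL) (sym (suc-pred (2 ^ (k * L)) {{m^n≢0 2 (k * L)}})))
                          (blocks-fixed 0 r)
    count : length (avoidingAll Ds) * suc b ^ r ≡ 2 ^ sum (map length Ds) * b ^ r
    count = subst (λ r′ → length (avoidingAll Ds) * suc b ^ r′ ≡ 2 ^ sum (map length Ds) * b ^ r′)
                  (length-blocks 0 r) (length-avoidingAll Ds 2^fixed≡1+b)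

  recurrence-null : Null (Π⁰₁ (recurrenceᴾ τ k))
  recurrence-null = Null-from-uniform-covers block-cover

proposition3p1 : (C : List Str) → NonEmpty (ClopenSet C) →
    (Z : Cantor) → KurtzRandom Z → MultiplyRecurrent (ClopenSet C) Z
proposition3p1 C (Y₀ , Y₀∈C) Z random k _ =
  let τ , τ∈C , _               = find Y₀∈C
      σ , (n , accepted) , σ≺Z = random (recurrenceᴾ τ k) (recurrence-null τ k)
      1≤n , occurs              = to (recurrenceᴾ-⇔ τ k σ n) accepted
  in n , 1≤n , λ i 1≤i i≤k →
       lose τ∈C (≺-resp-≗ (sym ∘ T^≗shift (n * i) Z) (⊑-≺ (occurs i 1≤i i≤k) (drop-≺ (n * i) σ≺Z)))
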